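{- Let $q \geq 0$ be an integer and let $D, D'$ be digraphs on $n$ vertices. If $|A(D)| \cdot |A(D')| < (q+1)n(n-1)$, then there exists a $q$-near-packing of $D$ and $D'$.
   Context: All digraphs are finite, without loops and without multiple arcs. For digraphs $D=(V,A)$ and $D'=(V',A')$ with $|V| \leq |V'|$ and an injection $f: V\to V'$, $f(D)$ denotes the digraph on $V'$ whose arcs are $f(u)f(v)$ for $uv \in A$. The injection $f$ is a $q$-near-packing of $D$ and $D'$ if $f(D)$ and $D'$ share at most $q$ arcs. -}

module Defs where

open import Data.Nat using (ℕ; _+_)
open import Data.Bool using (Bool; true; false; _∧_; if_then_else_)
open import Data.Fin using (Fin)
open import Data.Fin.Properties using (_≟_)
open import Data.List using (List; map; allFin; concatMap)
open import Data.Nat.ListAction using (sum)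
open import Data.Bool.ListAction using (any)
open import Data.Product using (_×_; _,_)
open import Relation.Binary.PropositionalEquality using (_≡_)
open import Relation.Nullary.Decidable using (⌊_⌋)
open import Function.Definitions using (Injective)

-- A digraph on vertex set Fin n: an arc relation (decidable, given as Bool)
-- with no loops.  Multiple arcs are impossible by construction.
record Digraph (n : ℕ) : Set where
  field
    arc      : Fin n → Fin n → Bool
    loopless : ∀ v → arc v v ≡ false
open Digraph public

pairs : (n : ℕ) → List (Fin n × Fin n)
pairs n = concatMap (λ u → map (λ v → (u , v)) (allFin n)) (allFin n)

count : {n : ℕ} → (Fin n → Fin n → Bool) → ℕ
count {n} r = sum (map (λ { (u , v) → if r u v then 1 else 0 }) (pairs n))

numArcs : {n : ℕ} → Digraph n → ℕ
numArcs D = count (arc D)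

imageArc : {n m : ℕ} → (Fin n → Fin m) → Digraph n → Fin m → Fin m → Bool
imageArc {n} f D x y =
  any (λ { (u , v) → arc D u v ∧ ⌊ f u ≟ x ⌋ ∧ ⌊ f v ≟ y ⌋ }) (pairs n)

sharedArcs : {n m : ℕ} → (Fin n → Fin m) → Digraph n → Digraph m → ℕ
sharedArcs f D D' = count (λ x y → imageArc f D x y ∧ arc D' x y)

NearPacking : {n m : ℕ} → ℕ → Digraph n → Digraph m → (Fin n → Fin m) → Set
NearPacking q D D' f = Injective _≡_ _≡_ f × sharedArcs f D D' Data.Nat.≤ q

-- Average the number of arcs shared by f(D) and D' over all injections f.  For u ≠ w, the
-- injections sending (u, w) to (x, y) are equally many for every pair x ≠ y, because
-- permutations act 2-transitively on the vertices; so an arc uw of D lands on an arc of D'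
-- for exactly a fraction |A(D')| / (n (n - 1)) of the injections.  Hence the average of the
-- number of shared arcs is at most |A(D)| |A(D')| / (n (n - 1)) < q + 1, and some injection is a
-- q-near-packing.
module Submission where

open import Defs
open import Data.Bool using (Bool; true; false; _∧_; _∨_; not; if_then_else_)
open import Data.Bool.ListAction using (any)
open import Data.Empty using (⊥-elim)
open import Data.Fin using (Fin; zero; suc)
open import Data.Fin.Permutation using (Permutation; _⟨$⟩ʳ_; transpose; _∘ₚ_)
open import Data.Fin.Properties using (_≟_; all?)
open import Data.List using (List; []; _∷_)
import Data.List as L using (map; tabulate; concatMap; allFin; _++_)
import Data.List.Properties as L using (map-++; map-∘)
open import Data.Nat using (ℕ; zero; suc; _+_; _*_; _∸_; _≤_; _<_; z≤n; s≤s⁻¹; _<?_; >-nonZero)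
open import Data.Nat.ListAction using (sum)
open import Data.Nat.ListAction.Properties using (sum-++)
open import Data.Nat.Properties hiding (_≟_)
open import Algebra.Properties.CommutativeSemigroup *-commutativeSemigroup
  using (x∙yz≈y∙xz; xy∙z≈xz∙y)
open import Algebra.Properties.Semiring.Sum +-*-semiring
  using (sum-syntax; sum-cong-≗; ∑-comm; *-distribˡ-sum; *-distribʳ-sum; ∑-permute; sum-replicate-zero)
open import Data.Nat.Tactic.RingSolver using (solve-∀)
open import Data.Product using (∃; _,_; _×_)
open import Data.Vec using (Vec; []; _∷_; lookup)
import Data.Vec as V using (map; allFin)
import Data.Vec.Properties as V using (lookup-map; lookup-allFin)
open import Function using (_∘_; mk⇔)
open import Function.Bundles using (Injection)
open import Function.Definitions using (Injective)
open import Function.Properties.Inverse using (↔⇒↣)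
open import Relation.Binary.PropositionalEquality
  using (_≡_; _≢_; refl; sym; trans; cong; cong₂; subst; subst₂; module ≡-Reasoning)
open import Relation.Nullary using (Dec; yes; no; ¬_; does)
open import Relation.Nullary.Decidable
  using (⌊_⌋; isYes≗does; does-⇔; dec-true; dec-false; map′; _→-dec_)

χ : Bool → ℕ
χ b = if b then 1 else 0

χ-∧ : ∀ a b → χ (a ∧ b) ≡ χ a * χ b
χ-∧ true b = sym (+-identityʳ (χ b))
χ-∧ false b = refl

χ-∨-≤ : ∀ a b → χ (a ∨ b) ≤ χ a + χ b
χ-∨-≤ true b = m≤m+n 1 (χ b)
χ-∨-≤ false b = ≤-refl

χ-any-≤ : ∀ {A : Set} (p : A → Bool) xs → χ (any p xs) ≤ sum (L.map (χ ∘ p) xs)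
χ-any-≤ p [] = z≤n
χ-any-≤ p (x ∷ xs) = ≤-trans (χ-∨-≤ (p x) (any p xs)) (+-monoʳ-≤ (χ (p x)) (χ-any-≤ p xs))

∑-const : ∀ n c → ∑[ i < n ] c ≡ n * c
∑-const zero c = refl
∑-const (suc n) c = cong (c +_) (∑-const n c)

∑-mono-≤ : ∀ {n} {f g : Fin n → ℕ} → (∀ i → f i ≤ g i) → ∑[ i < n ] f i ≤ ∑[ i < n ] g i
∑-mono-≤ {zero} f≤g = z≤n
∑-mono-≤ {suc n} f≤g = +-mono-≤ (f≤g zero) (∑-mono-≤ (f≤g ∘ suc))

≤-∑ : ∀ {n} (f : Fin n → ℕ) i → f i ≤ ∑[ j < n ] f j
≤-∑ f zero = m≤m+n (f zero) _
≤-∑ f (suc i) = ≤-trans (≤-∑ (f ∘ suc) i) (m≤n+m _ (f zero))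

∑-<⇒∃< : ∀ {n} {f g : Fin n → ℕ} → ∑[ i < n ] f i < ∑[ i < n ] g i → ∃ λ i → f i < g i
∑-<⇒∃< {suc n} {f} {g} ∑f<∑g with f zero <? g zero
... | yes f₀<g₀ = zero , f₀<g₀
... | no f₀≮g₀ with ∑-<⇒∃< {f = f ∘ suc} {g = g ∘ suc}
                      (+-cancelˡ-< (g zero) _ _ (≤-<-trans (+-monoˡ-≤ _ (≮⇒≥ f₀≮g₀)) ∑f<∑g))
...   | i , fᵢ<gᵢ = suc i , fᵢ<gᵢ

∑∑-cong : ∀ {a b} {g h : Fin a → Fin b → ℕ} → (∀ x y → g x y ≡ h x y) →
  ∑[ x < a ] ∑[ y < b ] g x y ≡ ∑[ x < a ] ∑[ y < b ] h x y
∑∑-cong {a} {b} g≡h = sum-cong-≗ {a} λ x → sum-cong-≗ {b} (g≡h x)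

∑∑-mono-≤ : ∀ {a b} {g h : Fin a → Fin b → ℕ} → (∀ x y → g x y ≤ h x y) →
  ∑[ x < a ] ∑[ y < b ] g x y ≤ ∑[ x < a ] ∑[ y < b ] h x y
∑∑-mono-≤ g≤h = ∑-mono-≤ λ x → ∑-mono-≤ (g≤h x)

*-distribˡ-∑∑ : ∀ {a b} c (g : Fin a → Fin b → ℕ) →
  c * ∑[ x < a ] ∑[ y < b ] g x y ≡ ∑[ x < a ] ∑[ y < b ] (c * g x y)
*-distribˡ-∑∑ {a} {b} c g =
  trans (*-distribˡ-sum c (λ x → ∑[ y < b ] g x y)) (sum-cong-≗ {a} λ x → *-distribˡ-sum c (g x))

*-distribʳ-∑∑ : ∀ {a b} c (g : Fin a → Fin b → ℕ) →
  (∑[ x < a ] ∑[ y < b ] g x y) * c ≡ ∑[ x < a ] ∑[ y < b ] (g x y * c)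
*-distribʳ-∑∑ {a} {b} c g =
  trans (*-distribʳ-sum c (λ x → ∑[ y < b ] g x y)) (sum-cong-≗ {a} λ x → *-distribʳ-sum c (g x))

∑∑-comm : ∀ {a b c d} (h : Fin a → Fin b → Fin c → Fin d → ℕ) →
  ∑[ x < a ] ∑[ y < b ] ∑[ u < c ] ∑[ w < d ] h x y u w ≡
  ∑[ u < c ] ∑[ w < d ] ∑[ x < a ] ∑[ y < b ] h x y u w
∑∑-comm {a} {b} {c} {d} h = begin
  ∑[ x < a ] ∑[ y < b ] ∑[ u < c ] ∑[ w < d ] h x y u w
    ≡⟨ sum-cong-≗ {a} (λ x → ∑-comm (λ y u → ∑[ w < d ] h x y u w)) ⟩
  ∑[ x < a ] ∑[ u < c ] ∑[ y < b ] ∑[ w < d ] h x y u w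
    ≡⟨ ∑-comm (λ x u → ∑[ y < b ] ∑[ w < d ] h x y u w) ⟩
  ∑[ u < c ] ∑[ x < a ] ∑[ y < b ] ∑[ w < d ] h x y u w
    ≡⟨ ∑∑-cong (λ u x → ∑-comm (λ y w → h x y u w)) ⟩
  ∑[ u < c ] ∑[ x < a ] ∑[ w < d ] ∑[ y < b ] h x y u w
    ≡⟨ sum-cong-≗ {c} (λ u → ∑-comm (λ x w → ∑[ y < b ] h x y u w)) ⟩
  ∑[ u < c ] ∑[ w < d ] ∑[ x < a ] ∑[ y < b ] h x y u w ∎
  where open ≡-Reasoning

-- Stated with does rather than ⌊_⌋ (= isYes), which does not compute through suc x ≟ suc y.
δ : ∀ {n} → Fin n → Fin n → ℕ
δ a x = χ (does (a ≟ x))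

∑-δ : ∀ {n} (a : Fin n) (g : Fin n → ℕ) → ∑[ x < n ] (δ a x * g x) ≡ g a
∑-δ {suc n} zero g = trans (cong₂ _+_ (+-identityʳ (g zero)) (sum-replicate-zero n)) (+-identityʳ _)
∑-δ {suc n} (suc a) g = ∑-δ a (g ∘ suc)

∑∑-δδ : ∀ {n} (a b : Fin n) (g : Fin n → Fin n → ℕ) →
  ∑[ x < n ] ∑[ y < n ] (δ a x * δ b y * g x y) ≡ g a b
∑∑-δδ {n} a b g = begin
  ∑[ x < n ] ∑[ y < n ] (δ a x * δ b y * g x y)
    ≡⟨ sum-cong-≗ {n} (λ x → trans (sum-cong-≗ {n} λ y → *-assoc (δ a x) (δ b y) (g x y))
                                   (sym (*-distribˡ-sum (δ a x) (λ y → δ b y * g x y)))) ⟩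
  ∑[ x < n ] (δ a x * ∑[ y < n ] (δ b y * g x y))
    ≡⟨ sum-cong-≗ {n} (λ x → cong (δ a x *_) (∑-δ b (g x))) ⟩
  ∑[ x < n ] (δ a x * g x b)
    ≡⟨ ∑-δ a (λ x → g x b) ⟩
  g a b ∎
  where open ≡-Reasoning

∑-≢ : ∀ {n} (a : Fin n) → ∑[ y < n ] χ (not (does (a ≟ y))) ≡ n ∸ 1
∑-≢ {suc n} zero = trans (∑-const n 1) (*-identityʳ n)
∑-≢ {suc (suc n)} (suc a) = cong suc (∑-≢ a)

∑∑-≢ : ∀ n → ∑[ x < n ] ∑[ y < n ] χ (not (does (x ≟ y))) ≡ n * (n ∸ 1)
∑∑-≢ n = trans (sum-cong-≗ {n} ∑-≢) (∑-const n (n ∸ 1))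

sum-map-tabulate : ∀ {A : Set} {n} (g : A → ℕ) (h : Fin n → A) →
  sum (L.map g (L.tabulate h)) ≡ ∑[ i < n ] g (h i)
sum-map-tabulate {n = zero} g h = refl
sum-map-tabulate {n = suc n} g h = cong (g (h zero) +_) (sum-map-tabulate g (h ∘ suc))

sum-map-concatMap : ∀ {A B : Set} (g : B → ℕ) (h : A → List B) xs →
  sum (L.map g (L.concatMap h xs)) ≡ sum (L.map (λ a → sum (L.map g (h a))) xs)
sum-map-concatMap g h [] = refl
sum-map-concatMap g h (x ∷ xs) = begin
  sum (L.map g (h x L.++ L.concatMap h xs))
    ≡⟨ cong sum (L.map-++ g (h x) (L.concatMap h xs)) ⟩
  sum (L.map g (h x) L.++ L.map g (L.concatMap h xs))
    ≡⟨ sum-++ (L.map g (h x)) _ ⟩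
  sum (L.map g (h x)) + sum (L.map g (L.concatMap h xs))
    ≡⟨ cong (sum (L.map g (h x)) +_) (sum-map-concatMap g h xs) ⟩
  sum (L.map g (h x)) + sum (L.map (λ a → sum (L.map g (h a))) xs) ∎
  where open ≡-Reasoning

count≡∑∑ : ∀ {n} (r : Fin n → Fin n → Bool) → count r ≡ ∑[ x < n ] ∑[ y < n ] χ (r x y)
count≡∑∑ {n} r = begin
  count r
    ≡⟨ sum-map-concatMap χr (λ x → L.map (x ,_) (L.allFin n)) (L.allFin n) ⟩
  sum (L.map (λ x → sum (L.map χr (L.map (x ,_) (L.allFin n)))) (L.allFin n))
    ≡⟨ sum-map-tabulate {n = n} _ (λ x → x) ⟩
  ∑[ x < n ] sum (L.map χr (L.map (x ,_) (L.allFin n)))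
    ≡⟨ sum-cong-≗ {n} (λ x → cong sum (sym (L.map-∘ (L.allFin n)))) ⟩
  ∑[ x < n ] sum (L.map (χr ∘ (x ,_)) (L.allFin n))
    ≡⟨ sum-cong-≗ {n} (λ x → sum-map-tabulate {n = n} _ (λ y → y)) ⟩
  ∑[ x < n ] ∑[ y < n ] χ (r x y) ∎
  where
  open ≡-Reasoning
  χr : Fin n × Fin n → ℕ
  χr (x , y) = χ (r x y)

-- The sum over all maps Fin k → Fin m, given as vectors so that the summands need not
-- respect pointwise equality of functions.
∑ᵛ : ∀ {m} k → (Vec (Fin m) k → ℕ) → ℕ
∑ᵛ zero g = g []
∑ᵛ {m} (suc k) g = ∑[ a < m ] ∑ᵛ k (λ w → g (a ∷ w))

∑ᵛ-cong : ∀ {m} k {g h : Vec (Fin m) k → ℕ} → (∀ v → g v ≡ h v) → ∑ᵛ k g ≡ ∑ᵛ k h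
∑ᵛ-cong zero g≡h = g≡h []
∑ᵛ-cong (suc k) g≡h = sum-cong-≗ (λ a → ∑ᵛ-cong k (λ w → g≡h (a ∷ w)))

∑ᵛ-mono-≤ : ∀ {m} k {g h : Vec (Fin m) k → ℕ} → (∀ v → g v ≤ h v) → ∑ᵛ k g ≤ ∑ᵛ k h
∑ᵛ-mono-≤ zero g≤h = g≤h []
∑ᵛ-mono-≤ (suc k) g≤h = ∑-mono-≤ (λ a → ∑ᵛ-mono-≤ k (λ w → g≤h (a ∷ w)))

*-distribˡ-∑ᵛ : ∀ {m} k c (g : Vec (Fin m) k → ℕ) → c * ∑ᵛ k g ≡ ∑ᵛ k (λ v → c * g v)
*-distribˡ-∑ᵛ zero c g = refl
*-distribˡ-∑ᵛ (suc k) c g =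
  trans (*-distribˡ-sum c (λ a → ∑ᵛ k (λ w → g (a ∷ w))))
        (sum-cong-≗ (λ a → *-distribˡ-∑ᵛ k c (λ w → g (a ∷ w))))

∑ᵛ-comm-∑ : ∀ {m n} k (h : Vec (Fin m) k → Fin n → ℕ) →
  ∑ᵛ k (λ v → ∑[ i < n ] h v i) ≡ ∑[ i < n ] ∑ᵛ k (λ v → h v i)
∑ᵛ-comm-∑ zero h = refl
∑ᵛ-comm-∑ (suc k) h =
  trans (sum-cong-≗ (λ a → ∑ᵛ-comm-∑ k (λ w → h (a ∷ w))))
        (∑-comm (λ a i → ∑ᵛ k (λ w → h (a ∷ w) i)))

∑ᵛ-comm-∑∑ : ∀ {m a b} k (h : Vec (Fin m) k → Fin a → Fin b → ℕ) →
  ∑ᵛ k (λ v → ∑[ x < a ] ∑[ y < b ] h v x y) ≡ ∑[ x < a ] ∑[ y < b ] ∑ᵛ k (λ v → h v x y)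
∑ᵛ-comm-∑∑ {a = a} {b} k h =
  trans (∑ᵛ-comm-∑ k (λ v x → ∑[ y < b ] h v x y)) (sum-cong-≗ {a} λ x → ∑ᵛ-comm-∑ k (λ v → h v x))

∑ᵛ-permute : ∀ {m} k (g : Vec (Fin m) k → ℕ) (π : Permutation m m) →
  ∑ᵛ k g ≡ ∑ᵛ k (λ v → g (V.map (π ⟨$⟩ʳ_) v))
∑ᵛ-permute zero g π = refl
∑ᵛ-permute (suc k) g π =
  trans (∑-permute (λ a → ∑ᵛ k (λ w → g (a ∷ w))) π)
        (sum-cong-≗ (λ a → ∑ᵛ-permute k (λ w → g ((π ⟨$⟩ʳ a) ∷ w)) π))

≤-∑ᵛ : ∀ {m} k (g : Vec (Fin m) k → ℕ) v → g v ≤ ∑ᵛ k g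
≤-∑ᵛ zero g [] = ≤-refl
≤-∑ᵛ {m} (suc k) g (a ∷ w) =
  ≤-trans (≤-∑ᵛ k (λ w → g (a ∷ w)) w) (≤-∑ {m} (λ a → ∑ᵛ k (λ w → g (a ∷ w))) a)

∑ᵛ-<⇒∃< : ∀ {m} k {g h : Vec (Fin m) k → ℕ} → ∑ᵛ k g < ∑ᵛ k h → ∃ λ v → g v < h v
∑ᵛ-<⇒∃< zero g<h = [] , g<h
∑ᵛ-<⇒∃< (suc k) ∑g<∑h with ∑-<⇒∃< ∑g<∑h
... | a , ∑gₐ<∑hₐ with ∑ᵛ-<⇒∃< k ∑gₐ<∑hₐ
...   | w , gᵥ<hᵥ = a ∷ w , gᵥ<hᵥ

⟨$⟩ʳ-injective : ∀ {m} (π : Permutation m m) → Injective _≡_ _≡_ (π ⟨$⟩ʳ_)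
⟨$⟩ʳ-injective π = Injection.injective (↔⇒↣ π)

transpose-matchˡ : ∀ {m} (i j : Fin m) → transpose i j ⟨$⟩ʳ i ≡ j
transpose-matchˡ i j with i ≟ i
... | yes _ = refl
... | no i≢i = ⊥-elim (i≢i refl)

transpose-fix : ∀ {m} {i j k : Fin m} → k ≢ i → k ≢ j → transpose i j ⟨$⟩ʳ k ≡ k
transpose-fix {i = i} {j} {k} k≢i k≢j with k ≟ i
... | yes k≡i = ⊥-elim (k≢i k≡i)
... | no _ with k ≟ j
...   | yes k≡j = ⊥-elim (k≢j k≡j)
...   | no _ = refl

-- Move x to x' by one transposition; the image of y is then ≠ x', so a second
-- transposition fixing x' moves it to y'.
permutation-2-transitive : ∀ {m} {x y x' y' : Fin m} → x ≢ y → x' ≢ y' →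
  ∃ λ (π : Permutation m m) → π ⟨$⟩ʳ x ≡ x' × π ⟨$⟩ʳ y ≡ y'
permutation-2-transitive {x = x} {y} {x'} {y'} x≢y x'≢y' =
  τ ∘ₚ σ , trans (cong (σ ⟨$⟩ʳ_) (transpose-matchˡ x x')) (transpose-fix x'≢τy x'≢y')
         , transpose-matchˡ (τ ⟨$⟩ʳ y) y'
  where
  τ σ : Permutation _ _
  τ = transpose x x'
  σ = transpose (τ ⟨$⟩ʳ y) y'
  x'≢τy : x' ≢ τ ⟨$⟩ʳ y
  x'≢τy x'≡τy = x≢y (⟨$⟩ʳ-injective τ (trans (transpose-matchˡ x x') x'≡τy))

δ-permute : ∀ {m} (π : Permutation m m) a b → δ (π ⟨$⟩ʳ a) (π ⟨$⟩ʳ b) ≡ δ a b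
δ-permute π a b =
  cong χ (does-⇔ (mk⇔ (⟨$⟩ʳ-injective π) (cong (π ⟨$⟩ʳ_))) (π ⟨$⟩ʳ a ≟ π ⟨$⟩ʳ b) (a ≟ b))

δ*δ-injective : ∀ {k m} {f : Fin k → Fin m} → Injective _≡_ _≡_ f →
  ∀ {u w} → u ≢ w → ∀ x → δ (f u) x * δ (f w) x ≡ 0
δ*δ-injective {f = f} inj {u} {w} u≢w x with f u ≟ x | f w ≟ x
... | no _ | _ = refl
... | yes _ | no _ = refl
... | yes fu≡x | yes fw≡x = ⊥-elim (u≢w (inj (trans fu≡x (sym fw≡x))))

injective? : ∀ {k m} (f : Fin k → Fin m) → Dec (Injective _≡_ _≡_ f)
injective? f = map′ (λ inj {i} {j} → inj i j) (λ inj i j → inj)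
  (all? λ i → all? λ j → (f i ≟ f j) →-dec (i ≟ j))

ι : ∀ {k m} → Vec (Fin m) k → ℕ
ι v = χ (does (injective? (lookup v)))

ι-yes : ∀ {k m} (v : Vec (Fin m) k) → Injective _≡_ _≡_ (lookup v) → ι v ≡ 1
ι-yes v inj = cong χ (dec-true (injective? _) inj)

ι-no : ∀ {k m} (v : Vec (Fin m) k) → ¬ Injective _≡_ _≡_ (lookup v) → ι v ≡ 0
ι-no v ¬inj = cong χ (dec-false (injective? _) ¬inj)

ι-permute : ∀ {k m} (π : Permutation m m) (v : Vec (Fin m) k) → ι (V.map (π ⟨$⟩ʳ_) v) ≡ ι v
ι-permute π v = cong χ (does-⇔ (mk⇔ to from) (injective? _) (injective? _))
  where
  πv-i : ∀ i → lookup (V.map (π ⟨$⟩ʳ_) v) i ≡ π ⟨$⟩ʳ lookup v i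
  πv-i i = V.lookup-map i (π ⟨$⟩ʳ_) v
  to : Injective _≡_ _≡_ (lookup (V.map (π ⟨$⟩ʳ_) v)) → Injective _≡_ _≡_ (lookup v)
  to inj {i} {j} vᵢ≡vⱼ = inj (trans (πv-i i) (trans (cong (π ⟨$⟩ʳ_) vᵢ≡vⱼ) (sym (πv-i j))))
  from : Injective _≡_ _≡_ (lookup v) → Injective _≡_ _≡_ (lookup (V.map (π ⟨$⟩ʳ_) v))
  from inj {i} {j} πvᵢ≡πvⱼ = inj (⟨$⟩ʳ-injective π (trans (sym (πv-i i)) (trans πvᵢ≡πvⱼ (πv-i j))))

ι*<*ι⇒injective×≤ : ∀ {k m} (v : Vec (Fin m) k) {s q} → ι v * s < suc q * ι v →
  Injective _≡_ _≡_ (lookup v) × s ≤ q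
ι*<*ι⇒injective×≤ v {s} {q} lt with injective? (lookup v)
... | yes inj = inj , s≤s⁻¹ (subst₂ _<_ (trans (cong (_* s) (ι-yes v inj)) (*-identityˡ s))
                                         (trans (cong (suc q *_) (ι-yes v inj)) (*-identityʳ (suc q))) lt)
... | no ¬inj = ⊥-elim (n≮0 (subst₂ _<_ (cong (_* s) (ι-no v ¬inj))
                                        (trans (cong (suc q *_) (ι-no v ¬inj)) (*-zeroʳ (suc q))) lt))

#Inj : ℕ → ℕ → ℕ
#Inj k m = ∑ᵛ k (ι {k} {m})

0<#Inj : ∀ n → 0 < #Inj n n
0<#Inj n = ≤-trans (≤-reflexive (sym (ι-yes (V.allFin n) allFin-injective))) (≤-∑ᵛ n ι (V.allFin n))
  where
  allFin-injective : Injective _≡_ _≡_ (lookup (V.allFin n))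
  allFin-injective {i} {j} eq = trans (sym (V.lookup-allFin i)) (trans eq (V.lookup-allFin j))

#Inj[_↦_,_↦_] : ∀ {k m} → Fin k → Fin m → Fin k → Fin m → ℕ
#Inj[_↦_,_↦_] {k} u x w y = ∑ᵛ k (λ v → ι v * (δ (lookup v u) x * δ (lookup v w) y))

#Inj[]-permute : ∀ {k m} (π : Permutation m m) (u w : Fin k) x y →
  #Inj[ u ↦ π ⟨$⟩ʳ x , w ↦ π ⟨$⟩ʳ y ] ≡ #Inj[ u ↦ x , w ↦ y ]
#Inj[]-permute {k} π u w x y = trans (∑ᵛ-permute k _ π) (∑ᵛ-cong k λ v →
  cong₂ _*_ (ι-permute π v) (cong₂ _*_ (δ-πv v u x) (δ-πv v w y)))
  where
  δ-πv : ∀ v i z → δ (lookup (V.map (π ⟨$⟩ʳ_) v) i) (π ⟨$⟩ʳ z) ≡ δ (lookup v i) z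
  δ-πv v i z = trans (cong (λ a → δ a (π ⟨$⟩ʳ z)) (V.lookup-map i (π ⟨$⟩ʳ_) v)) (δ-permute π _ z)

#Inj[]-off-diagonal : ∀ {k m} (u w : Fin k) {x y x' y' : Fin m} → x ≢ y → x' ≢ y' →
  #Inj[ u ↦ x , w ↦ y ] ≡ #Inj[ u ↦ x' , w ↦ y' ]
#Inj[]-off-diagonal u w x≢y x'≢y' with permutation-2-transitive x≢y x'≢y'
... | π , πx≡x' , πy≡y' =
  trans (sym (#Inj[]-permute π u w _ _)) (cong₂ (λ a b → #Inj[ u ↦ a , w ↦ b ]) πx≡x' πy≡y')

#Inj[]-diagonal : ∀ {k m} {u w : Fin k} → u ≢ w → (x : Fin m) → #Inj[ u ↦ x , w ↦ x ] ≡ 0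
#Inj[]-diagonal {k} {m} {u} {w} u≢w x =
  trans (∑ᵛ-cong k term) (sym (*-distribˡ-∑ᵛ k 0 (λ _ → 0)))
  where
  term : (v : Vec (Fin m) k) → ι v * (δ (lookup v u) x * δ (lookup v w) x) ≡ 0
  term v with injective? (lookup v)
  ... | no ¬inj = cong (_* (δ (lookup v u) x * δ (lookup v w) x)) (ι-no v ¬inj)
  ... | yes inj = trans (cong (ι v *_) (δ*δ-injective inj u≢w x)) (*-zeroʳ (ι v))

∑∑#Inj[] : ∀ {k m} (u w : Fin k) → ∑[ x < m ] ∑[ y < m ] #Inj[ u ↦ x , w ↦ y ] ≡ #Inj k m
∑∑#Inj[] {k} {m} u w = begin
  ∑[ x < m ] ∑[ y < m ] #Inj[ u ↦ x , w ↦ y ]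
    ≡⟨ ∑ᵛ-comm-∑∑ k (λ v x y → ι v * (δ (lookup v u) x * δ (lookup v w) y)) ⟨
  ∑ᵛ k (λ v → ∑[ x < m ] ∑[ y < m ] (ι v * (δ (lookup v u) x * δ (lookup v w) y)))
    ≡⟨ ∑ᵛ-cong k (λ v → trans (∑∑-cong λ x y → *-comm (ι v) (δ (lookup v u) x * δ (lookup v w) y))
                              (∑∑-δδ (lookup v u) (lookup v w) (λ _ _ → ι v))) ⟩
  #Inj k m ∎
  where open ≡-Reasoning

-- #Inj[ u ↦ x , w ↦ y ] is the same for all m (m ∸ 1) pairs x ≢ y, and these pairs
-- partition the injections.
#Inj[]-regular : ∀ {k m} {u w : Fin k} {x y : Fin m} → u ≢ w → x ≢ y →
  #Inj[ u ↦ x , w ↦ y ] * (m * (m ∸ 1)) ≡ #Inj k m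
#Inj[]-regular {k} {m} {u} {w} {x} {y} u≢w x≢y = begin
  N * (m * (m ∸ 1))
    ≡⟨ cong (N *_) (∑∑-≢ m) ⟨
  N * ∑[ x' < m ] ∑[ y' < m ] χ (not (does (x' ≟ y')))
    ≡⟨ *-distribˡ-∑∑ {m} {m} N (λ x' y' → χ (not (does (x' ≟ y')))) ⟩
  ∑[ x' < m ] ∑[ y' < m ] (N * χ (not (does (x' ≟ y'))))
    ≡⟨ ∑∑-cong term ⟩
  ∑[ x' < m ] ∑[ y' < m ] #Inj[ u ↦ x' , w ↦ y' ]
    ≡⟨ ∑∑#Inj[] u w ⟩
  #Inj k m ∎
  where
  open ≡-Reasoning
  N : ℕ
  N = #Inj[ u ↦ x , w ↦ y ]
  term : ∀ x' y' → N * χ (not (does (x' ≟ y'))) ≡ #Inj[ u ↦ x' , w ↦ y' ]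
  term x' y' with x' ≟ y'
  ... | yes refl = trans (*-zeroʳ N) (sym (#Inj[]-diagonal u≢w x'))
  ... | no x'≢y' = trans (*-identityʳ N) (#Inj[]-off-diagonal u w x≢y x'≢y')

#Inj[_,_↦_] : ∀ {k m} → Fin k → Fin k → Digraph m → ℕ
#Inj[_,_↦_] {k} u w D' = ∑ᵛ k (λ v → ι v * χ (arc D' (lookup v u) (lookup v w)))

#Inj[,↦]-expand : ∀ {k m} (u w : Fin k) (D' : Digraph m) →
  #Inj[ u , w ↦ D' ] ≡ ∑[ x < m ] ∑[ y < m ] (χ (arc D' x y) * #Inj[ u ↦ x , w ↦ y ])
#Inj[,↦]-expand {k} {m} u w D' = begin
  ∑ᵛ k (λ v → ι v * A' (lookup v u) (lookup v w))
    ≡⟨ ∑ᵛ-cong k (λ v → trans (sym (∑∑-δδ (lookup v u) (lookup v w) (λ x y → ι v * A' x y)))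
                              (∑∑-cong λ x y →
                                rearrange (δ (lookup v u) x) (δ (lookup v w) y) (ι v) (A' x y))) ⟩
  ∑ᵛ k (λ v → ∑[ x < m ] ∑[ y < m ] (A' x y * E v x y))
    ≡⟨ ∑ᵛ-comm-∑∑ k (λ v x y → A' x y * E v x y) ⟩
  ∑[ x < m ] ∑[ y < m ] ∑ᵛ k (λ v → A' x y * E v x y)
    ≡⟨ ∑∑-cong (λ x y → *-distribˡ-∑ᵛ k (A' x y) (λ v → E v x y)) ⟨
  ∑[ x < m ] ∑[ y < m ] (A' x y * #Inj[ u ↦ x , w ↦ y ]) ∎
  where
  open ≡-Reasoning
  A' : Fin m → Fin m → ℕ
  A' x y = χ (arc D' x y)
  E : Vec (Fin m) k → Fin m → Fin m → ℕ
  E v x y = ι v * (δ (lookup v u) x * δ (lookup v w) y)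
  rearrange : ∀ a b i c → a * b * (i * c) ≡ c * (i * (a * b))
  rearrange = solve-∀

arc⇒≢ : ∀ {n} (G : Digraph n) {x y} → arc G x y ≡ true → x ≢ y
arc⇒≢ G {x} arcxx refl with trans (sym arcxx) (loopless G x)
... | ()

#Inj[,↦]-regular : ∀ {k m} {u w : Fin k} (D' : Digraph m) → u ≢ w →
  #Inj[ u , w ↦ D' ] * (m * (m ∸ 1)) ≡ numArcs D' * #Inj k m
#Inj[,↦]-regular {k} {m} {u} {w} D' u≢w = begin
  #Inj[ u , w ↦ D' ] * K
    ≡⟨ cong (_* K) (#Inj[,↦]-expand u w D') ⟩
  (∑[ x < m ] ∑[ y < m ] (A' x y * #Inj[ u ↦ x , w ↦ y ])) * K
    ≡⟨ *-distribʳ-∑∑ K (λ x y → A' x y * #Inj[ u ↦ x , w ↦ y ]) ⟩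
  ∑[ x < m ] ∑[ y < m ] (A' x y * #Inj[ u ↦ x , w ↦ y ] * K)
    ≡⟨ ∑∑-cong term ⟩
  ∑[ x < m ] ∑[ y < m ] (A' x y * #Inj k m)
    ≡⟨ *-distribʳ-∑∑ (#Inj k m) A' ⟨
  (∑[ x < m ] ∑[ y < m ] A' x y) * #Inj k m
    ≡⟨ cong (_* #Inj k m) (count≡∑∑ (arc D')) ⟨
  numArcs D' * #Inj k m ∎
  where
  open ≡-Reasoning
  K : ℕ
  K = m * (m ∸ 1)
  A' : Fin m → Fin m → ℕ
  A' x y = χ (arc D' x y)
  term : ∀ x y → A' x y * #Inj[ u ↦ x , w ↦ y ] * K ≡ A' x y * #Inj k m
  term x y with arc D' x y in arcxy
  ... | false = refl
  ... | true = trans (*-assoc 1 #Inj[ u ↦ x , w ↦ y ] K)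
                     (cong (1 *_) (#Inj[]-regular u≢w (arc⇒≢ D' arcxy)))

χ-imageArc-≤ : ∀ {k m} (f : Fin k → Fin m) (D : Digraph k) x y →
  χ (imageArc f D x y) ≤ ∑[ u < k ] ∑[ w < k ] (χ (arc D u w) * (δ (f u) x * δ (f w) y))
χ-imageArc-≤ {k} f D x y = begin
  χ (imageArc f D x y)
    ≤⟨ χ-any-≤ _ (pairs k) ⟩
  count (λ u w → arc D u w ∧ ⌊ f u ≟ x ⌋ ∧ ⌊ f w ≟ y ⌋)
    ≡⟨ count≡∑∑ (λ u w → arc D u w ∧ ⌊ f u ≟ x ⌋ ∧ ⌊ f w ≟ y ⌋) ⟩
  ∑[ u < k ] ∑[ w < k ] χ (arc D u w ∧ ⌊ f u ≟ x ⌋ ∧ ⌊ f w ≟ y ⌋)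
    ≡⟨ ∑∑-cong (λ u w → χ-∧∧ (arc D u w) (f u ≟ x) (f w ≟ y)) ⟩
  ∑[ u < k ] ∑[ w < k ] (χ (arc D u w) * (δ (f u) x * δ (f w) y)) ∎
  where
  open ≤-Reasoning
  χ-∧∧ : ∀ {A B : Set} a (p : Dec A) (q : Dec B) →
    χ (a ∧ ⌊ p ⌋ ∧ ⌊ q ⌋) ≡ χ a * (χ (does p) * χ (does q))
  χ-∧∧ a p q = trans (χ-∧ a _) (cong (χ a *_) (trans (χ-∧ ⌊ p ⌋ ⌊ q ⌋)
    (cong₂ (λ b c → χ b * χ c) (isYes≗does p) (isYes≗does q))))

sharedArcs-≤ : ∀ {k m} (f : Fin k → Fin m) (D : Digraph k) (D' : Digraph m) →
  sharedArcs f D D' ≤ ∑[ u < k ] ∑[ w < k ] (χ (arc D u w) * χ (arc D' (f u) (f w)))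
sharedArcs-≤ {k} {m} f D D' = begin
  sharedArcs f D D'
    ≡⟨ count≡∑∑ (λ x y → imageArc f D x y ∧ arc D' x y) ⟩
  ∑[ x < m ] ∑[ y < m ] χ (imageArc f D x y ∧ arc D' x y)
    ≡⟨ ∑∑-cong (λ x y → χ-∧ (imageArc f D x y) (arc D' x y)) ⟩
  ∑[ x < m ] ∑[ y < m ] (χ (imageArc f D x y) * A' x y)
    ≤⟨ ∑∑-mono-≤ (λ x y → *-monoˡ-≤ (A' x y) (χ-imageArc-≤ f D x y)) ⟩
  ∑[ x < m ] ∑[ y < m ] ((∑[ u < k ] ∑[ w < k ] (A u w * E x y u w)) * A' x y)
    ≡⟨ ∑∑-cong (λ x y → *-distribʳ-∑∑ (A' x y) (λ u w → A u w * E x y u w)) ⟩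
  ∑[ x < m ] ∑[ y < m ] ∑[ u < k ] ∑[ w < k ] (A u w * E x y u w * A' x y)
    ≡⟨ ∑∑-comm (λ x y u w → A u w * E x y u w * A' x y) ⟩
  ∑[ u < k ] ∑[ w < k ] ∑[ x < m ] ∑[ y < m ] (A u w * E x y u w * A' x y)
    ≡⟨ ∑∑-cong (λ u w → trans (∑∑-cong (λ x y → *-assoc (A u w) (E x y u w) (A' x y)))
                             (sym (*-distribˡ-∑∑ (A u w) (λ x y → E x y u w * A' x y)))) ⟩
  ∑[ u < k ] ∑[ w < k ] (A u w * ∑[ x < m ] ∑[ y < m ] (E x y u w * A' x y))
    ≡⟨ ∑∑-cong (λ u w → cong (A u w *_) (∑∑-δδ (f u) (f w) A')) ⟩
  ∑[ u < k ] ∑[ w < k ] (A u w * A' (f u) (f w)) ∎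
  where
  open ≤-Reasoning
  A : Fin k → Fin k → ℕ
  A u w = χ (arc D u w)
  A' : Fin m → Fin m → ℕ
  A' x y = χ (arc D' x y)
  E : Fin m → Fin m → Fin k → Fin k → ℕ
  E x y u w = δ (f u) x * δ (f w) y

∑ᵛ-ι*∑∑≡∑∑*#Inj : ∀ {k m} (D : Digraph k) (D' : Digraph m) →
  ∑ᵛ k (λ v → ι v * ∑[ u < k ] ∑[ w < k ] (χ (arc D u w) * χ (arc D' (lookup v u) (lookup v w)))) ≡
  ∑[ u < k ] ∑[ w < k ] (χ (arc D u w) * #Inj[ u , w ↦ D' ])
∑ᵛ-ι*∑∑≡∑∑*#Inj {k} D D' = begin
  ∑ᵛ k (λ v → ι v * ∑[ u < k ] ∑[ w < k ] (A u w * A'ᵛ v u w))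
    ≡⟨ ∑ᵛ-cong k (λ v → *-distribˡ-∑∑ (ι v) (λ u w → A u w * A'ᵛ v u w)) ⟩
  ∑ᵛ k (λ v → ∑[ u < k ] ∑[ w < k ] (ι v * (A u w * A'ᵛ v u w)))
    ≡⟨ ∑ᵛ-comm-∑∑ k (λ v u w → ι v * (A u w * A'ᵛ v u w)) ⟩
  ∑[ u < k ] ∑[ w < k ] ∑ᵛ k (λ v → ι v * (A u w * A'ᵛ v u w))
    ≡⟨ ∑∑-cong (λ u w → ∑ᵛ-cong k λ v → x∙yz≈y∙xz (ι v) (A u w) (A'ᵛ v u w)) ⟩
  ∑[ u < k ] ∑[ w < k ] ∑ᵛ k (λ v → A u w * (ι v * A'ᵛ v u w))
    ≡⟨ ∑∑-cong (λ u w → *-distribˡ-∑ᵛ k (A u w) (λ v → ι v * A'ᵛ v u w)) ⟨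
  ∑[ u < k ] ∑[ w < k ] (A u w * #Inj[ u , w ↦ D' ]) ∎
  where
  open ≡-Reasoning
  A : Fin k → Fin k → ℕ
  A u w = χ (arc D u w)
  A'ᵛ : Vec (Fin _) k → Fin k → Fin k → ℕ
  A'ᵛ v u w = χ (arc D' (lookup v u) (lookup v w))

∑ᵛ-ι*sharedArcs-≤ : ∀ {k m} (D : Digraph k) (D' : Digraph m) →
  ∑ᵛ k (λ v → ι v * sharedArcs (lookup v) D D') * (m * (m ∸ 1)) ≤ numArcs D * numArcs D' * #Inj k m
∑ᵛ-ι*sharedArcs-≤ {k} {m} D D' = begin
  ∑ᵛ k (λ v → ι v * sharedArcs (lookup v) D D') * K
    ≤⟨ *-monoˡ-≤ K (∑ᵛ-mono-≤ k λ v → *-monoʳ-≤ (ι v) (sharedArcs-≤ (lookup v) D D')) ⟩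
  ∑ᵛ k (λ v → ι v * ∑[ u < k ] ∑[ w < k ] (A u w * χ (arc D' (lookup v u) (lookup v w)))) * K
    ≡⟨ cong (_* K) (∑ᵛ-ι*∑∑≡∑∑*#Inj D D') ⟩
  (∑[ u < k ] ∑[ w < k ] (A u w * #Inj[ u , w ↦ D' ])) * K
    ≡⟨ *-distribʳ-∑∑ K (λ u w → A u w * #Inj[ u , w ↦ D' ]) ⟩
  ∑[ u < k ] ∑[ w < k ] (A u w * #Inj[ u , w ↦ D' ] * K)
    ≡⟨ ∑∑-cong term ⟩
  ∑[ u < k ] ∑[ w < k ] (A u w * (numArcs D' * #Inj k m))
    ≡⟨ *-distribʳ-∑∑ (numArcs D' * #Inj k m) A ⟨
  (∑[ u < k ] ∑[ w < k ] A u w) * (numArcs D' * #Inj k m)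
    ≡⟨ cong (_* (numArcs D' * #Inj k m)) (count≡∑∑ (arc D)) ⟨
  numArcs D * (numArcs D' * #Inj k m)
    ≡⟨ *-assoc (numArcs D) (numArcs D') (#Inj k m) ⟨
  numArcs D * numArcs D' * #Inj k m ∎
  where
  open ≤-Reasoning
  K : ℕ
  K = m * (m ∸ 1)
  A : Fin k → Fin k → ℕ
  A u w = χ (arc D u w)
  term : ∀ u w → A u w * #Inj[ u , w ↦ D' ] * K ≡ A u w * (numArcs D' * #Inj k m)
  term u w with arc D u w in arcuw
  ... | false = refl
  ... | true = trans (*-assoc 1 #Inj[ u , w ↦ D' ] K)
                     (cong (1 *_) (#Inj[,↦]-regular D' (arc⇒≢ D arcuw)))

lemma1 : (q n : ℕ) (D D' : Digraph n) →
    numArcs D * numArcs D' < suc q * n * (n ∸ 1) →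
    ∃ λ (f : Fin n → Fin n) → NearPacking q D D' f
lemma1 q n D D' |D||D'|<[q+1]n[n-1] with ∑ᵛ-<⇒∃< n average<
  where
  T J K : ℕ
  T = ∑ᵛ n (λ v → ι v * sharedArcs (lookup v) D D')
  J = #Inj n n
  K = n * (n ∸ 1)
  instance _ = >-nonZero (0<#Inj n)
  T*K<[q+1]*J*K : T * K < suc q * J * K
  T*K<[q+1]*J*K = begin-strict
    T * K                       ≤⟨ ∑ᵛ-ι*sharedArcs-≤ D D' ⟩
    numArcs D * numArcs D' * J  <⟨ *-monoˡ-< J |D||D'|<[q+1]K ⟩
    suc q * K * J               ≡⟨ xy∙z≈xz∙y (suc q) K J ⟩
    suc q * J * K               ∎
    where
    open ≤-Reasoning
    |D||D'|<[q+1]K : numArcs D * numArcs D' < suc q * K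
    |D||D'|<[q+1]K = subst (numArcs D * numArcs D' <_) (*-assoc (suc q) n (n ∸ 1)) |D||D'|<[q+1]n[n-1]
  average< : T < ∑ᵛ n (λ v → suc q * ι v)
  average< = subst (T <_) (*-distribˡ-∑ᵛ n (suc q) ι) (*-cancelʳ-< K T (suc q * J) T*K<[q+1]*J*K)
... | v , ι*s<[q+1]*ι = lookup v , ι*<*ι⇒injective×≤ v ι*s<[q+1]*ι
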